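{- For every infinite set $D\subseteq\omega$ with $0\notin D$, there exist a bounded complexity measure $\psi$ and a nonempty closed class $A$ of decision tables from $\mathcal{M}_k^2$ such that $G_{\psi,A}(n)=H_D(n)$ for every $n\in\omega$.
   Context: Fix an integer $k\ge 2$; $\omega=\{0,1,2,\ldots\}$, $E_k=\{0,1,\ldots,k-1\}$, $E_2=\{0,1\}$. Let $P=\{f_i:i\in\omega\}$ be a set of attribute names ($f_i\ne f_j$ for $i\ne j$). $\mathcal{M}_k^2$ is the set of rectangular tables filled with numbers from $E_k$ whose columns are labeled with pairwise different attributes from $P$, whose rows are pairwise different, and in which each row is labeled with a decision from $E_2$. Tables without rows also belong to $\mathcal{M}_k^2$ and are all denoted $\Lambda$. Tables differing only by a permutation of rows are equal. $P(T)$ is the set of column attributes. $\mathcal{M}_k^2\mathcal{C}$ is the set of tables in which all rows have the same decision ($\Lambda$ included). $T(f_{i_1},\delta_1)\cdots(f_{i_m},\delta_m)$ is the table of rows of $T$ having values $\delta_1,\ldots,\delta_m$ in the columns labeled $f_{i_1},\ldots,f_{i_m}$. Operations: for $D\subseteq P(T)$, $I(D,T)$ deletes the columns labeled by $D$ and, in each group of rows coinciding on the remaining columns, keeps one row with the minimum decision; $I(P(T),T)=\Lambda$. For $\nu:E_k^{|P(T)|}\to E_2$, $J(\nu,T)$ replaces the decision of each row $\bar\delta$ by $\nu(\bar\delta)$. $[T]=\{J(\nu,I(D,T)):D\subseteq P(T),\nu:E_k^{|P(T)\setminus D|}\to E_2\}$; $[A]=\bigcup_{T\in A}[T]$; nonempty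 $A$ is a closed class if $[A]=A$. A $k$-decision tree: finite directed rooted tree with at least two nodes, root and its leaving edges unlabeled, terminal nodes labeled with decisions from $E_2$, other nodes labeled with attributes from $P$ whose leaving edges are labeled with numbers from $E_k$; $P(\Gamma)$ is the set of attributes at nodes. For a complete path $\tau=v_1,d_1,\ldots,v_m,d_m,v_{m+1}$ (root to terminal node), $F(\tau)$ is the empty word if $m=1$, else $f_{i_2}\cdots f_{i_m}$ where $v_j$ is labeled $f_{i_j}$; $T(\tau)=T$ if $m=1$, else $T(f_{i_2},\delta_2)\cdots(f_{i_m},\delta_m)$ with $d_j$ labeled $\delta_j$. For $T\notin\mathcal{M}_k^2\mathcal{C}$, a strongly nondeterministic decision tree for $T$: all terminal nodes labeled $1$, $P(\Gamma)\subseteq P(T)$, every row with decision $1$ lies in some $T(\tau)$, and for every complete path either $T(\tau)=\Lambda$ or all rows of $T(\tau)$ have decision $1$. Let $B$ be the set of finite words over $P$ (with empty word $\lambda$). A complexity measure is $\psi:B\to\omega$ with $\psi(\alpha)=0$ iff $\alpha=\lambda$, invariant under permutation of letters, $\psi(\alpha_1)\le\psi(\alpha_1\alpha_2)\le\psi(\alpha_1)+\psi(\alpha_2)$; bounded if $\psi(\alpha)\ge|\alpha|$. For finite $D\subseteq P$: $\psi(\emptyset)=0$, $\psi(\{f_{i_1},\ldots,f_{i_m}\})=\psi(f_{i_1}\cdots f_{i_m})$. $\psi(\Gamma)=\max_\tau\psi(F(\tau))$ over complete paths. For $T\ne\Lambda$: $\psi^s(T)=0$ if $T\in\mathcal{M}_k^2\mathcal{C}$,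 otherwise the minimum of $\psi(\Gamma)$ over strongly nondeterministic decision trees for $T$; $W_\psi(T)=\psi(P(T))$; both $0$ on $\Lambda$. $G_{\psi,A}(n)=\max\{\psi^s(T):T\in A,W_\psi(T)\le n\}$. For infinite $D=\{n_i:i\in\omega\}\subseteq\omega$ with $n_i<n_{i+1}$: $H_D(n)=0$ if $n<n_0$, $H_D(n)=n_i$ if $n_i\le n<n_{i+1}$. -}

module Defs where

open import Data.Nat using (ℕ; zero; suc; _≤_; _<_; _+_; _⊔_; _≟_)
open import Data.Fin using (Fin; zero; suc)
import Data.Fin.Properties as FinP
open import Data.Bool using (Bool; true; false; if_then_else_; _∧_)
open import Data.List using (List; []; _∷_; _++_; map; filter; zip; foldr; concatMap; mapMaybe; length; allFin; [_])
open import Data.List.Properties using () renaming (≡-dec to ≡-decL)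
open import Data.Maybe using (Maybe; just; nothing)
open import Data.Maybe.Properties using () renaming (≡-dec to ≡-decM)
import Data.Maybe as Maybe
open import Data.Product using (Σ; ∃; ∃-syntax; _×_; _,_; proj₁; proj₂)
open import Data.Sum using (_⊎_)
open import Data.Empty using (⊥)
open import Relation.Nullary using (¬_; does; ¬?)
open import Relation.Binary.PropositionalEquality using (_≡_)
open import Data.List.Membership.Propositional using (_∈_)
open import Data.List.Membership.DecPropositional _≟_ using (_∈?_)
open import Data.List.Relation.Unary.All using (All)
open import Data.List.Relation.Unary.Unique.Propositional using (Unique)
import Data.List.Relation.Unary.Unique.Propositional.Properties as UniqP
open import Data.List.Relation.Binary.Permutation.Propositional using (_↭_)
open import Function.Bundles using (_⇔_)

-- Attributes f_i are identified with their indices i : ℕ.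
-- Words over P (the set B) are lists of attributes: List ℕ.
-- Decisions E_2 = Fin 2.

one : Fin 2
one = suc zero

record ComplexityMeasure (ψ : List ℕ → ℕ) : Set where
  field
    zero-iff  : ∀ α → ψ α ≡ 0 ⇔ α ≡ []
    perm-inv  : ∀ α β → α ↭ β → ψ α ≡ ψ β
    mono      : ∀ α₁ α₂ → ψ α₁ ≤ ψ (α₁ ++ α₂)
    subadd    : ∀ α₁ α₂ → ψ (α₁ ++ α₂) ≤ ψ α₁ + ψ α₂

Bounded : (List ℕ → ℕ) → Set
Bounded ψ = ∀ α → length α ≤ ψ α

Infinite : (ℕ → Bool) → Set
Infinite D = ∀ n → ∃[ m ] (n ≤ m × D m ≡ true)

-- H D n = the largest element of D that is ≤ n, or 0 if there is none
-- (for 0 ∉ D this is exactly H_D of the paper).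
H : (ℕ → Bool) → ℕ → ℕ
H D zero    = 0
H D (suc n) = if D (suc n) then suc n else H D n

module _ (k : ℕ) where

  -- A table: list of pairwise different column attributes, and for each
  -- tuple of values (a list of length |cols|) either no row (nothing) or
  -- a row with a decision (just d).  Rows are thus automatically pairwise
  -- different, and row order is not represented at all.
  record Table : Set where
    field
      cols  : List ℕ
      uniq  : Unique cols
      entry : List (Fin k) → Maybe (Fin 2)
  open Table public

  -- r is a row of T with decision d.  (A table with no columns has no rows.)
  RowOf : Table → List (Fin k) → Fin 2 → Set
  RowOf T r d = (0 < length (cols T)) × (length r ≡ length (cols T)) × (entry T r ≡ just d)

  IsEmpty : Table → Set
  IsEmpty T = ∀ r d → ¬ RowOf T r d

  _≈_ : Table → Table → Set
  T ≈ T' = (IsEmpty T × IsEmpty T')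
         ⊎ (cols T ≡ cols T' × (∀ r → length r ≡ length (cols T) → entry T r ≡ entry T' r))

  InC : Table → Set
  InC T = ∀ r r' d d' → RowOf T r d → RowOf T r' d' → d ≡ d'

  allRows : ℕ → List (List (Fin k))
  allRows zero    = [ [] ]
  allRows (suc n) = concatMap (λ a → map (a ∷_) (allRows n)) (allFin k)

  min2 : Fin 2 → Fin 2 → Fin 2
  min2 zero    e = zero
  min2 (suc _) e = e

  minDec : List (Fin 2) → Maybe (Fin 2)
  minDec []       = nothing
  minDec (d ∷ ds) with minDec ds
  ... | nothing = just d
  ... | just e  = just (min2 d e)

  -- I(D,T): delete the columns labelled by D, keep in each group of
  -- coinciding rows one row with minimal decision.
  I : Table → List ℕ → Table
  I T D = record
    { cols  = filter (λ f → ¬? (f ∈? D)) (cols T)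
    ; uniq  = UniqP.filter⁺ (λ f → ¬? (f ∈? D)) (uniq T)
    ; entry = λ w → minDec (mapMaybe
                (λ r → if does (≡-decL FinP._≟_ (proj r) w) then entry T r else nothing)
                (allRows (length (cols T))))
    }
    where
    proj : List (Fin k) → List (Fin k)
    proj r = map proj₂ (filter (λ p → ¬? (proj₁ p ∈? D)) (zip (cols T) r))

  J : (List (Fin k) → Fin 2) → Table → Table
  J ν T = record
    { cols  = cols T
    ; uniq  = uniq T
    ; entry = λ r → Maybe.map (λ _ → ν r) (entry T r)
    }

  InClosure : (Table → Set) → Table → Set
  InClosure A T' = ∃[ T ] (A T × ∃[ D ] (All (_∈ cols T) D
                     × ∃[ ν ] (J ν (I T D) ≈ T')))

  ClosedClass : (Table → Set) → Set
  ClosedClass A = (∃[ T ] A T) × (∀ T' → InClosure A T' ⇔ A T')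

  valAt : List ℕ → List (Fin k) → ℕ → Maybe (Fin k)
  valAt (c ∷ cs) (x ∷ xs) f = if does (c ≟ f) then just x else valAt cs xs f
  valAt _        _        f = nothing

  sat : List ℕ → List (Fin k) → List (ℕ × Fin k) → Bool
  sat cs r []             = true
  sat cs r ((f , δ) ∷ ps) = does (≡-decM FinP._≟_ (valAt cs r f) (just δ)) ∧ sat cs r ps

  restrict : Table → List (ℕ × Fin k) → Table
  restrict T ps = record
    { cols  = cols T
    ; uniq  = uniq T
    ; entry = λ r → if sat (cols T) r ps then entry T r else nothing
    }

  -- A non-root node: terminal (labelled by a decision)
  -- or labelled by an attribute with a nonempty list of leaving edges,
  -- each labelled by a number from E_k.  The (unlabelled) root has a
  -- nonempty list of children, so the tree has at least two nodes.
  data Node : Set where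
    leaf : Fin 2 → Node
    node : ℕ → Fin k × Node → List (Fin k × Node) → Node

  record DTree : Set where
    constructor droot
    field
      child₀   : Node
      children : List Node

  -- complete paths from a node: the list of (attribute, edge label) pairs
  -- along the path and the decision at its terminal node
  mutual
    pathsN : Node → List (List (ℕ × Fin k) × Fin 2)
    pathsN (leaf d) = [ ([] , d) ]
    pathsN (node f (a , n) es) =
      map (λ p → ((f , a) ∷ proj₁ p , proj₂ p)) (pathsN n) ++ pathsE f es

    pathsE : ℕ → List (Fin k × Node) → List (List (ℕ × Fin k) × Fin 2)
    pathsE f [] = []
    pathsE f ((a , n) ∷ es) =
      map (λ p → ((f , a) ∷ proj₁ p , proj₂ p)) (pathsN n) ++ pathsE f es

  paths : DTree → List (List (ℕ × Fin k) × Fin 2)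
  paths (droot c cs) = concatMap pathsN (c ∷ cs)

  mutual
    attrsN : Node → List ℕ
    attrsN (leaf _) = []
    attrsN (node f (a , n) es) = f ∷ attrsN n ++ attrsE es

    attrsE : List (Fin k × Node) → List ℕ
    attrsE [] = []
    attrsE ((a , n) ∷ es) = attrsN n ++ attrsE es

  attrs : DTree → List ℕ
  attrs (droot c cs) = concatMap attrsN (c ∷ cs)

  ψTree : (List ℕ → ℕ) → DTree → ℕ
  ψTree ψ Γ = foldr _⊔_ 0 (map (λ p → ψ (map proj₁ (proj₁ p))) (paths Γ))

  StronglyND : DTree → Table → Set
  StronglyND Γ T =
      (∀ ps d → (ps , d) ∈ paths Γ → d ≡ one)
    × (∀ f → f ∈ attrs Γ → f ∈ cols T)
    × (∀ r → RowOf T r one → ∃[ ps ] ∃[ d ] ((ps , d) ∈ paths Γ × RowOf (restrict T ps) r one))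
    × (∀ ps d → (ps , d) ∈ paths Γ → IsEmpty (restrict T ps)
         ⊎ (∀ r d' → RowOf (restrict T ps) r d' → d' ≡ one))

  PsiS : (List ℕ → ℕ) → Table → ℕ → Set
  PsiS ψ T m = (InC T × m ≡ 0)
             ⊎ (¬ InC T × (∃[ Γ ] (StronglyND Γ T × ψTree ψ Γ ≡ m))
                        × (∀ Γ → StronglyND Γ T → m ≤ ψTree ψ Γ))

  W≤ : (List ℕ → ℕ) → Table → ℕ → Set
  W≤ ψ T n = IsEmpty T ⊎ ψ (cols T) ≤ n

  GEq : (List ℕ → ℕ) → (Table → Set) → ℕ → ℕ → Set
  GEq ψ A n h = (∃[ T ] (A T × W≤ ψ T n × PsiS ψ T h))
              × (∀ T m → A T → W≤ ψ T n → PsiS ψ T m → m ≤ h)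

{-# OPTIONS --safe #-}
module Submission where

-- ψ charges i + 1 for each occurrence of the attribute f_i. The class A consists of the tables
-- without rows and the one-column tables over attributes f_i with i + 1 ∈ D; it is closed since
-- I either deletes that column, leaving no rows, or keeps it, and J only relabels decisions.
-- A one-column table over f_i outside M_k^2 C has ψ^s = i + 1 = W_ψ: every strongly
-- nondeterministic tree must query f_i, and querying it once for each value whose row has
-- decision 1 suffices. Hence G_{ψ,A}(n) is the largest element of D not exceeding n, or 0.

open import Data.Nat using (ℕ; zero; suc; _≤_; _<_; _+_; _⊔_; z≤n; s≤s; _≟_)
open import Data.Bool using (Bool; true; false; if_then_else_; _∧_)
open import Data.Empty using (⊥-elim)
open import Data.Fin using (Fin; zero; suc)
import Data.Fin.Properties as FinP
open import Data.Fin.Properties using (any?)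
open import Data.List using (List; []; _∷_; _++_; [_]; map; length; filter; foldr; concatMap; mapMaybe; allFin)
open import Data.List.Properties
  using (map-++; length-filter; concatMap-map; concatMap-pure; ∷-injectiveˡ; foldr-preservesᵇ)
  renaming (≡-dec to ≡-decL)
open import Data.List.Membership.Propositional using (_∈_)
open import Data.List.Membership.Propositional.Properties
  using (∈-map⁺; ∈-map⁻; ∈-concatMap⁻; ∈-allFin; ∈-filter⁺; ∈-filter⁻)
open import Data.List.Membership.DecPropositional _≟_ using (_∈?_)
open import Data.List.Relation.Binary.Permutation.Propositional.Properties using (map⁺)
import Data.List.Relation.Unary.All as All
import Data.List.Relation.Unary.All.Properties as AllP
open import Data.List.Relation.Unary.All using ([])
open import Data.List.Relation.Unary.AllPairs using ([]; _∷_)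
open import Data.List.Relation.Unary.Any using (here; there; satisfied)
open import Data.List.Relation.Unary.Unique.Propositional using (Unique)
import Data.List.Relation.Unary.Unique.Propositional.Properties as UniqP
open import Data.Maybe using (Maybe; just; nothing; fromMaybe)
import Data.Maybe as Maybe
open import Data.Maybe.Properties using (just-injective) renaming (≡-dec to ≡-decM)
open import Data.Nat.ListAction using (sum)
open import Data.Nat.ListAction.Properties using (sum-++; sum-↭)
open import Data.Nat.Properties
  using (≤-trans; ≤-refl; ≤-reflexive; ≤-antisym; m≤m+n; m≤n+m; m≤m⊔n; m≤n⊔m; ⊔-lub; +-identityʳ;
         m≤n⇒m≤1+n; m≤n⇒m<n∨m≡n)
open import Data.Product using (∃-syntax; _×_; _,_; proj₁; proj₂; map₁)
open import Data.Sum using (_⊎_; inj₁; inj₂)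
open import Function using (_∘_; case_of_)
open import Function.Bundles using (_⇔_; mk⇔)
open import Relation.Binary.PropositionalEquality using (_≡_; _≢_; refl; sym; trans; cong; subst; ≢-sym)
open import Relation.Nullary using (¬_; Dec; yes; no; does; ¬?)
open import Relation.Nullary.Decidable using (dec-true; dec-false)

open import Defs

weight : List ℕ → ℕ
weight α = sum (map suc α)

weight-++ : ∀ α β → weight (α ++ β) ≡ weight α + weight β
weight-++ α β = trans (cong sum (map-++ suc α β)) (sum-++ (map suc α) (map suc β))

weight≡0⇔[] : ∀ α → weight α ≡ 0 ⇔ α ≡ []
weight≡0⇔[] []      = mk⇔ (λ _ → refl) (λ _ → refl)
weight≡0⇔[] (_ ∷ _) = mk⇔ (λ ()) (λ ())

weight-complexityMeasure : ComplexityMeasure weight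
weight-complexityMeasure = record
  { zero-iff = weight≡0⇔[]
  ; perm-inv = λ α β α↭β → sum-↭ (map⁺ suc α↭β)
  ; mono     = λ α β → subst (weight α ≤_) (sym (weight-++ α β)) (m≤m+n _ _)
  ; subadd   = λ α β → ≤-reflexive (weight-++ α β)
  }

weight-bounded : Bounded weight
weight-bounded []      = z≤n
weight-bounded (f ∷ α) = s≤s (≤-trans (weight-bounded α) (m≤n+m _ f))

weight-[_] : ∀ i → weight [ i ] ≡ suc i
weight-[ i ] = +-identityʳ (suc i)

H≡0⊎∈ : ∀ D n → H D n ≡ 0 ⊎ ∃[ j ] (H D n ≡ suc j × D (suc j) ≡ true × suc j ≤ n)
H≡0⊎∈ D zero = inj₁ refl
H≡0⊎∈ D (suc n) with D (suc n) in Dn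
... | true  = inj₂ (n , refl , Dn , ≤-refl)
... | false with H≡0⊎∈ D n
...   | inj₁ H≡0                   = inj₁ H≡0
...   | inj₂ (j , H≡j , Dj , j≤n) = inj₂ (j , H≡j , Dj , m≤n⇒m≤1+n j≤n)

≤-H : ∀ D {j n} → D j ≡ true → j ≤ n → j ≤ H D n
≤-H D {zero}              _  _   = z≤n
≤-H D {suc j} {suc n} Dj j≤n with D (suc n) in Dn | m≤n⇒m<n∨m≡n j≤n
... | true  | _              = j≤n
... | false | inj₁ (s≤s j<n) = ≤-H D Dj j<n
... | false | inj₂ refl      with trans (sym Dj) Dn
...   | ()

length≡1 : ∀ {A : Set} (r : List A) → length r ≡ 1 → ∃[ a ] (r ≡ [ a ])
length≡1 (a ∷ []) _ = a , refl

if-just : ∀ {A : Set} b {x : Maybe A} {y} → (if b then x else nothing) ≡ just y → x ≡ just y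
if-just true eq = eq

does-∧ : ∀ {X : Set} (x? : Dec X) {b} → does x? ∧ b ≡ true → X
does-∧ (yes x) _ = x

if-does-just : ∀ {X A : Set} (x? : Dec X) {a b : A} → (if does x? then just a else nothing) ≡ just b → X × a ≡ b
if-does-just (yes x) refl = x , refl

map-const-fromMaybe : ∀ (m : Maybe (Fin 2)) → Maybe.map (λ _ → fromMaybe zero m) m ≡ m
map-const-fromMaybe (just _) = refl
map-const-fromMaybe nothing  = refl

∈⇒≤-foldr-⊔ : ∀ {x xs} → x ∈ xs → x ≤ foldr _⊔_ 0 xs
∈⇒≤-foldr-⊔ (here refl) = m≤m⊔n _ _
∈⇒≤-foldr-⊔ (there x∈)  = ≤-trans (∈⇒≤-foldr-⊔ x∈) (m≤n⊔m _ _)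

module _ {k : ℕ} where

  column : ℕ → (List (Fin k) → Maybe (Fin 2)) → Table k
  column i e = record { cols = [ i ] ; uniq = [] ∷ [] ; entry = e }

  RowOf-column : ∀ {i e r d} → RowOf k (column i e) r d → ∃[ a ] (r ≡ [ a ] × e [ a ] ≡ just d)
  RowOf-column {r = r} (_ , len , row) with length≡1 r len
  ... | a , refl = a , refl , row

  noRows : Table k
  noRows = column 0 (λ _ → nothing)

  noRows-IsEmpty : IsEmpty k noRows
  noRows-IsEmpty r d row with RowOf-column {0} {λ _ → nothing} {r} row
  ... | _ , _ , ()

  IsEmpty⇒InC : ∀ T → IsEmpty k T → InC k T
  IsEmpty⇒InC _ empty r _ d _ row _ = ⊥-elim (empty r d row)

  noColumns⇒IsEmpty : ∀ T → cols T ≡ [] → IsEmpty k T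
  noColumns⇒IsEmpty T eq r d (nonempty , _) with subst (λ c → 0 < length c) eq nonempty
  ... | ()

  IsEmpty-resp-≈ : ∀ T T' → _≈_ k T T' → IsEmpty k T → IsEmpty k T'
  IsEmpty-resp-≈ _ _ (inj₁ (_ , empty')) _ = empty'
  IsEmpty-resp-≈ _ _ (inj₂ (refl , entry≡)) empty r d (nonempty , len , row) =
    empty r d (nonempty , len , trans (entry≡ r len) row)

  IsEmpty-J : ∀ ν T → IsEmpty k T → IsEmpty k (J k ν T)
  IsEmpty-J ν T empty r d (nonempty , len , row) with entry T r in eq
  ... | just d' = empty r d' (nonempty , len , eq)

  minDec-mapMaybe-just : ∀ {A : Set} (g : A → Maybe (Fin 2)) l {d} →
    minDec k (mapMaybe g l) ≡ just d → ∃[ r ] (r ∈ l × ∃[ y ] (g r ≡ just y))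
  minDec-mapMaybe-just g (r ∷ l) eq with g r in gr
  ... | just y  = r , here refl , y , gr
  ... | nothing with minDec-mapMaybe-just g l eq
  ...   | r' , r'∈ , y , gr' = r' , there r'∈ , y , gr'

  length-allRows : ∀ n {r} → r ∈ allRows k n → length r ≡ n
  length-allRows zero    (here refl) = refl
  length-allRows (suc n) r∈ with satisfied (∈-concatMap⁻ _ {xs = allFin k} r∈)
  ... | a , r∈a with ∈-map⁻ (a ∷_) r∈a
  ...   | r' , r'∈ , refl = cong suc (length-allRows n r'∈)

  IsEmpty-I : ∀ T D → IsEmpty k T → IsEmpty k (I k T D)
  IsEmpty-I T D empty w d (nonempty , _ , row)
    with minDec-mapMaybe-just _ (allRows k (length (cols T))) row
  ... | r , r∈ , y , gr =
    empty r y ( ≤-trans nonempty (length-filter (λ f → ¬? (f ∈? D)) (cols T))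
              , length-allRows _ r∈
              , if-just _ gr )

  mapMaybe-nothing-on : ∀ {A : Set} (g : A → Maybe (Fin 2)) {l} →
    (∀ {b} → b ∈ l → g b ≡ nothing) → mapMaybe g l ≡ []
  mapMaybe-nothing-on g {[]}    _       = refl
  mapMaybe-nothing-on g {b ∷ l} none rewrite none (here refl) =
    mapMaybe-nothing-on g (none ∘ there)

  minDec-mapMaybe-unique : ∀ {A : Set} (g : A → Maybe (Fin 2)) {a l} → Unique l → a ∈ l →
    (∀ {b} → b ∈ l → b ≢ a → g b ≡ nothing) → minDec k (mapMaybe g l) ≡ g a
  minDec-mapMaybe-unique g {a} {a ∷ l} (a∉ ∷ _) (here refl) others
    with g a | mapMaybe-nothing-on g {l} (λ b∈ → others (there b∈) (≢-sym (All.lookup a∉ b∈)))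
  ... | just y  | rest≡[] rewrite rest≡[] = refl
  ... | nothing | rest≡[] = cong (minDec k) rest≡[]
  minDec-mapMaybe-unique g {a} {b ∷ l} (b∉ ∷ u) (there a∈) others
    rewrite others (here refl) (All.lookup b∉ a∈) = minDec-mapMaybe-unique g u a∈ (others ∘ there)

  allRows-1 : allRows k 1 ≡ map [_] (allFin k)
  allRows-1 = trans (sym (concatMap-map [_] [_] (allFin k))) (concatMap-pure (map [_] (allFin k)))

  minDec-mapMaybe-allRows-1 : ∀ (g : List (Fin k) → Maybe (Fin 2)) a →
    (∀ b → b ≢ a → g [ b ] ≡ nothing) → minDec k (mapMaybe g (allRows k 1)) ≡ g [ a ]
  minDec-mapMaybe-allRows-1 g a others rewrite allRows-1 =
    minDec-mapMaybe-unique g (UniqP.map⁺ ∷-injectiveˡ (UniqP.allFin⁺ k)) (∈-map⁺ [_] (∈-allFin a))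
      others′
    where
    others′ : ∀ {r} → r ∈ map [_] (allFin k) → r ≢ [ a ] → g r ≡ nothing
    others′ r∈ r≢a with ∈-map⁻ [_] r∈
    ... | b , _ , refl = others b (r≢a ∘ cong [_])

  select-≢ : ∀ {w r : List (Fin k)} (x : Maybe (Fin 2)) → r ≢ w →
    (if does (≡-decL FinP._≟_ r w) then x else nothing) ≡ nothing
  select-≢ {w} {r} x r≢w rewrite dec-false (≡-decL FinP._≟_ r w) r≢w = refl

  select-self : ∀ {w : List (Fin k)} (x : Maybe (Fin 2)) →
    (if does (≡-decL FinP._≟_ w w) then x else nothing) ≡ x
  select-self {w} x rewrite dec-true (≡-decL FinP._≟_ w w) refl = refl

  entry-I-column : ∀ i e a → entry (I k (column i e) []) [ a ] ≡ e [ a ]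
  entry-I-column i e a =
    trans (minDec-mapMaybe-allRows-1 _ a λ b b≢a → select-≢ {[ a ]} {[ b ]} (e [ b ]) (b≢a ∘ ∷-injectiveˡ))
          (select-self {[ a ]} (e [ a ]))

  SingleColumn : (ℕ → Bool) → Table k → Set
  SingleColumn D T = IsEmpty k T ⊎ ∃[ i ] (D (suc i) ≡ true × cols T ≡ [ i ])

  InClosure⇒SingleColumn : ∀ D T → InClosure k (SingleColumn D) T → SingleColumn D T
  InClosure⇒SingleColumn D T (_ , _ , _ , _ , _ , inj₁ (_ , empty)) = inj₁ empty
  InClosure⇒SingleColumn D T (T₀ , inj₁ empty , Ds , _ , ν , T₀≈T) =
    inj₁ (IsEmpty-resp-≈ (J k ν (I k T₀ Ds)) T T₀≈T (IsEmpty-J ν (I k T₀ Ds) (IsEmpty-I T₀ Ds empty)))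
  InClosure⇒SingleColumn D T (T₀ , inj₂ (i , Di , cols≡) , Ds , _ , _ , inj₂ (cols-I≡ , _))
    with i ∈? Ds | trans (sym cols-I≡) (cong (filter (λ f → ¬? (f ∈? Ds))) cols≡)
  ... | yes _ | cols≡[]  = inj₁ (noColumns⇒IsEmpty T cols≡[])
  ... | no  _ | cols≡[i] = inj₂ (i , Di , cols≡[i])

  SingleColumn⇒InClosure : ∀ D T → SingleColumn D T → InClosure k (SingleColumn D) T
  SingleColumn⇒InClosure D T (inj₁ empty) =
    T , inj₁ empty , [] , [] , (λ _ → zero)
    , inj₁ (IsEmpty-J (λ _ → zero) (I k T []) (IsEmpty-I T [] empty) , empty)
  SingleColumn⇒InClosure D record { uniq = [] ∷ [] ; entry = e } (inj₂ (i , Di , refl)) =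
    column i e , inj₂ (i , Di , refl) , [] , [] , fromMaybe zero ∘ e , inj₂ (refl , same-entries)
    where
    same-entries : ∀ r → length r ≡ 1 → entry (J k (fromMaybe zero ∘ e) (I k (column i e) [])) r ≡ e r
    same-entries r len with length≡1 r len
    ... | a , refl = trans (cong (Maybe.map _) (entry-I-column i e a)) (map-const-fromMaybe (e [ a ]))

  SingleColumn-closed : ∀ D → ClosedClass k (SingleColumn D)
  SingleColumn-closed D =
    (noRows , inj₁ noRows-IsEmpty)
    , λ T → mk⇔ (InClosure⇒SingleColumn D T) (SingleColumn⇒InClosure D T)

  sat-column : ∀ {i a f δ ps} → sat k [ i ] [ a ] ((f , δ) ∷ ps) ≡ true → f ≡ i × a ≡ δ
  sat-column {i} {a} {f} {δ} sat≡ =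
    map₁ sym (if-does-just (i ≟ f) (does-∧ (≡-decM FinP._≟_ (valAt k [ i ] [ a ] f) (just δ)) sat≡))

  sat-column-self : ∀ {i a} → sat k [ i ] [ a ] [ (i , a) ] ≡ true
  sat-column-self {i} {a} rewrite dec-true (i ≟ i) refl | dec-true (a FinP.≟ a) refl = refl

  RowOf-restrict : ∀ T ps {r d} → RowOf k (restrict k T ps) r d →
    sat k (cols T) r ps ≡ true × RowOf k T r d
  RowOf-restrict T ps {r} (nonempty , len , row) with sat k (cols T) r ps
  ... | true = refl , nonempty , len , row

  restrict-RowOf : ∀ T ps {r d} → sat k (cols T) r ps ≡ true → RowOf k T r d →
    RowOf k (restrict k T ps) r d
  restrict-RowOf T ps sat≡ (nonempty , len , row) rewrite sat≡ = nonempty , len , row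

  column-decision-one : ∀ {i e} → ¬ InC k (column i e) → ∃[ a ] (e [ a ] ≡ just one)
  column-decision-one {i} {e} ¬C with any? (λ a → ≡-decM FinP._≟_ (e [ a ]) (just one))
  ... | yes found = found
  ... | no  none  = ⊥-elim (¬C λ _ _ _ _ row row' → trans (decision-zero row) (sym (decision-zero row')))
    where
    decision-zero : ∀ {r d} → RowOf k (column i e) r d → d ≡ zero
    decision-zero {r} {d} row with RowOf-column {i} {e} {r} row
    ... | a , _ , e≡d with d
    ...   | zero     = refl
    ...   | suc zero = ⊥-elim (none (a , e≡d))

  ≤-ψTree : ∀ ψ Γ {ps d} → (ps , d) ∈ paths k Γ → ψ (map proj₁ ps) ≤ ψTree k ψ Γ
  ≤-ψTree ψ Γ τ∈ = ∈⇒≤-foldr-⊔ (∈-map⁺ (λ τ → ψ (map proj₁ (proj₁ τ))) τ∈)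

  ψTree≤ : ∀ ψ Γ {m} → (∀ {ps d} → (ps , d) ∈ paths k Γ → ψ (map proj₁ ps) ≤ m) → ψTree k ψ Γ ≤ m
  ψTree≤ ψ Γ {m} bound = foldr-preservesᵇ {P = _≤ m} ⊔-lub z≤n (AllP.map⁺ (All.tabulate bound))

  fanNode : ℕ → Fin k → Node k
  fanNode i b = node i (b , leaf one) []

  fan : ℕ → Fin k → List (Fin k) → DTree k
  fan i a bs = droot (fanNode i a) (map (fanNode i) bs)

  paths-fanNodes : ∀ i bs →
    concatMap (pathsN k) (map (fanNode i) bs) ≡ map (λ b → [ (i , b) ] , one) bs
  paths-fanNodes i []       = refl
  paths-fanNodes i (b ∷ bs) = cong (([ (i , b) ] , one) ∷_) (paths-fanNodes i bs)

  ∈-paths-fan : ∀ i a bs {τ} → τ ∈ paths k (fan i a bs) →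
    ∃[ b ] (b ∈ a ∷ bs × τ ≡ ([ (i , b) ] , one))
  ∈-paths-fan i a bs {τ} τ∈ = ∈-map⁻ _ (subst (τ ∈_) (paths-fanNodes i (a ∷ bs)) τ∈)

  fan-path : ∀ i a bs {b} → b ∈ a ∷ bs → ([ (i , b) ] , one) ∈ paths k (fan i a bs)
  fan-path i a bs {b} b∈ =
    subst (([ (i , b) ] , one) ∈_) (sym (paths-fanNodes i (a ∷ bs))) (∈-map⁺ _ b∈)

  attrs-fanNodes : ∀ i bs {f} → f ∈ concatMap (attrsN k) (map (fanNode i) bs) → f ≡ i
  attrs-fanNodes i (b ∷ bs) (here f≡i) = f≡i
  attrs-fanNodes i (b ∷ bs) (there f∈) = attrs-fanNodes i bs f∈

  ψTree-fan : ∀ i a bs → ψTree k weight (fan i a bs) ≤ suc i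
  ψTree-fan i a bs = ψTree≤ weight (fan i a bs) λ τ∈ → case ∈-paths-fan i a bs τ∈ of λ where
    (_ , _ , refl) → ≤-reflexive weight-[ i ]

  decisionOneValues : (List (Fin k) → Maybe (Fin 2)) → List (Fin k)
  decisionOneValues e = filter (λ b → ≡-decM FinP._≟_ (e [ b ]) (just one)) (allFin k)

  column-fan-StronglyND : ∀ {i e a} → e [ a ] ≡ just one →
    StronglyND k (fan i a (decisionOneValues e)) (column i e)
  column-fan-StronglyND {i} {e} {a} ea =
      (λ _ _ τ∈ → case ∈-paths-fan i a (decisionOneValues e) τ∈ of λ where (_ , _ , refl) → refl)
    , (λ _ f∈ → here (attrs-fanNodes i (a ∷ decisionOneValues e) f∈))
    , covers
    , λ _ _ τ∈ → case ∈-paths-fan i a (decisionOneValues e) τ∈ of λ where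
        (b , b∈ , refl) → inj₂ (one-decisions b∈)
    where
    labelled-one : ∀ {b} → b ∈ a ∷ decisionOneValues e → e [ b ] ≡ just one
    labelled-one (here refl) = ea
    labelled-one (there b∈) = proj₂ (∈-filter⁻ _ {xs = allFin k} b∈)

    covers : ∀ r → RowOf k (column i e) r one → ∃[ ps ] ∃[ d ]
      ((ps , d) ∈ paths k (fan i a (decisionOneValues e)) × RowOf k (restrict k (column i e) ps) r one)
    covers r row with RowOf-column {i} {e} {r} row
    ... | b , refl , eb = [ (i , b) ] , one , fan-path i a _ (there (∈-filter⁺ _ (∈-allFin b) eb))
                        , restrict-RowOf (column i e) [ (i , b) ] (sat-column-self {i} {b}) row

    one-decisions : ∀ {b} → b ∈ a ∷ decisionOneValues e →
      ∀ r d → RowOf k (restrict k (column i e) [ (i , b) ]) r d → d ≡ one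
    one-decisions {b} b∈ r d row with RowOf-restrict (column i e) [ (i , b) ] {r} row
    ... | sat≡ , row′ with RowOf-column {i} {e} {r} row′
    ...   | c , refl , ec with sat-column {i} {c} {i} {b} {[]} sat≡
    ...     | _ , refl = just-injective (trans (sym ec) (labelled-one b∈))

  -- The path covering a row with decision 1 cannot be empty (else every row would have
  -- decision 1), so it queries f_i.
  column-ψTree-lower : ∀ {i e} → ¬ InC k (column i e) → ∀ Γ → StronglyND k Γ (column i e) →
    suc i ≤ ψTree k weight Γ
  column-ψTree-lower {i} {e} ¬C Γ (_ , _ , covers , pure) with column-decision-one {i} {e} ¬C
  ... | a , ea with covers [ a ] (s≤s z≤n , refl , ea)
  ...   | [] , d , τ∈ , row with pure [] d τ∈
  ...     | inj₁ empty   = ⊥-elim (empty [ a ] one row)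
  ...     | inj₂ all-one = ⊥-elim (¬C λ r r' d d' row row' → trans (all-one r d row) (sym (all-one r' d' row')))
  column-ψTree-lower {i} {e} ¬C Γ (_ , _ , covers , pure) | a , ea | (f , δ) ∷ ps , d , τ∈ , row
    with sat-column {i} {a} {f} {δ} {ps} (proj₁ (RowOf-restrict (column i e) ((f , δ) ∷ ps) row))
  ... | refl , _ = ≤-trans (m≤m+n (suc i) _) (≤-ψTree weight Γ τ∈)

  PsiS-column : ∀ {i e} → ¬ InC k (column i e) → PsiS k weight (column i e) (suc i)
  PsiS-column {i} {e} ¬C with column-decision-one {i} {e} ¬C
  ... | a , ea = inj₂ (¬C , (Γ , Γ-nd , Γ-optimal) , column-ψTree-lower ¬C)
    where
    Γ = fan i a (decisionOneValues e)
    Γ-nd = column-fan-StronglyND {i} {e} {a} ea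
    Γ-optimal = ≤-antisym (ψTree-fan i a (decisionOneValues e)) (column-ψTree-lower ¬C Γ Γ-nd)

  PsiS-functional : ∀ {ψ T m m'} → PsiS k ψ T m → PsiS k ψ T m' → m ≡ m'
  PsiS-functional (inj₁ (_ , refl)) (inj₁ (_ , refl)) = refl
  PsiS-functional (inj₁ (C , _)) (inj₂ (¬C , _)) = ⊥-elim (¬C C)
  PsiS-functional (inj₂ (¬C , _)) (inj₁ (C , _)) = ⊥-elim (¬C C)
  PsiS-functional (inj₂ (_ , (Γ , nd , refl) , minimal)) (inj₂ (_ , (Γ' , nd' , refl) , minimal')) =
    ≤-antisym (minimal Γ' nd') (minimal' Γ nd)

  G-upper : ∀ D n T m → SingleColumn D T → W≤ k weight T n → PsiS k weight T m → m ≤ H D n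
  G-upper D n T m _ _ (inj₁ (_ , refl)) = z≤n
  G-upper D n T m (inj₁ empty) _ (inj₂ (¬C , _)) = ⊥-elim (¬C (IsEmpty⇒InC T empty))
  G-upper D n T m (inj₂ _) (inj₁ empty) (inj₂ (¬C , _)) = ⊥-elim (¬C (IsEmpty⇒InC T empty))
  G-upper D n record { uniq = [] ∷ [] ; entry = e } m (inj₂ (i , Di , refl)) (inj₂ w≤n) ψˢ@(inj₂ (¬C , _)) =
    subst (_≤ H D n) (PsiS-functional {weight} {column i e} (PsiS-column ¬C) ψˢ)
          (≤-H D Di (subst (_≤ n) weight-[ i ] w≤n))

  G-lower : ∀ D n (e : List (Fin k) → Maybe (Fin 2)) → (∀ j → ¬ InC k (column j e)) →
    ∃[ T ] (SingleColumn D T × W≤ k weight T n × PsiS k weight T (H D n))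
  G-lower D n e ¬C with H≡0⊎∈ D n
  ... | inj₁ H≡0 rewrite H≡0 =
    noRows , inj₁ noRows-IsEmpty , inj₁ noRows-IsEmpty , inj₁ (IsEmpty⇒InC noRows noRows-IsEmpty , refl)
  ... | inj₂ (j , H≡j , Dj , j≤n) rewrite H≡j =
    column j e , inj₂ (j , Dj , refl) , inj₂ (subst (_≤ n) (sym weight-[ j ]) j≤n) , PsiS-column (¬C j)

splitDecisions : ∀ {K} → List (Fin (suc (suc K))) → Maybe (Fin 2)
splitDecisions (zero ∷ _) = just zero
splitDecisions _          = just one

column-splitDecisions-¬InC : ∀ {K} j → ¬ InC (suc (suc K)) (column j splitDecisions)
column-splitDecisions-¬InC j C with C [ zero ] [ suc zero ] zero one (s≤s z≤n , refl , refl) (s≤s z≤n , refl , refl)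
... | ()

theorem9 : (k : ℕ) → 2 ≤ k → (D : ℕ → Bool) → Infinite D → D 0 ≡ false →
    ∃[ ψ ] (ComplexityMeasure ψ × Bounded ψ
      × ∃[ A ] (ClosedClass k A × (∀ n → GEq k ψ A n (H D n))))
theorem9 (suc (suc K)) (s≤s (s≤s z≤n)) D _ _ =
  weight , weight-complexityMeasure , weight-bounded , SingleColumn D , SingleColumn-closed D
  , λ n → G-lower D n splitDecisions column-splitDecisions-¬InC , G-upper D n
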